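{- Fix integers $b,t\ge 1$ and a real $\delta>0$. Then for all sufficiently large $n$ (depending on $b,t,\delta$), \[ \tau_t(K_n^b)\le (1+\delta)tn, \] where $K_n^b$ is the Cartesian product of $b$ copies of the complete graph $K_n$.
   Context: $K_n^b$ has vertex set $[n]^b$, with two vertices adjacent iff they differ in exactly one coordinate (so the distance between two vertices is their Hamming distance). For an integer $t\ge1$, a $t$-tone coloring of a graph $G$ assigns to each vertex $v$ a set $f(v)$ of exactly $t$ colors from a color set $C$ such that $|f(u)\cap f(v)|<d(u,v)$ for all distinct vertices $u,v$, where $d(u,v)$ is the graph distance. $\tau_t(G)$ is the minimum $|C|$ over all $t$-tone colorings of $G$.
   Formalization: The parameter δ ranges over the positive rationals instead of the positive reals. -}

module Defs where

open import Data.Nat using (ℕ; zero; suc; _+_; _<_)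
open import Data.Fin using (Fin; _≟_)
open import Data.Fin.Subset using (Subset; _∩_; ∣_∣)
open import Data.Vec using (Vec; []; _∷_)
open import Data.Bool using (if_then_else_)
open import Data.Product using (_×_)
open import Relation.Nullary using (¬_; does)
open import Relation.Binary.PropositionalEquality using (_≡_)

-- Vertices of K_n^b : words of length b over the alphabet [n] = Fin n.
Vertex : ℕ → ℕ → Set
Vertex n b = Vec (Fin n) b

-- Hamming distance = graph distance in K_n^b (number of differing coordinates).
dist : ∀ {n b} → Vertex n b → Vertex n b → ℕ
dist [] [] = 0
dist (x ∷ xs) (y ∷ ys) = (if does (x ≟ y) then 0 else 1) + dist xs ys

IsToneColoring : (t n b m : ℕ) → (Vertex n b → Subset m) → Set
IsToneColoring t n b m f =
  (∀ v → ∣ f v ∣ ≡ t) ×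
  (∀ u v → ¬ (u ≡ v) → ∣ f u ∩ f v ∣ < dist u v)

-- A Reed–Solomon-type colouring. Let K = t + b and pick a modulus q ≥ n with
-- q ≡ 1 (mod K!), so that every nonzero difference of integers in [0, K) is
-- invertible modulo q. A vertex u ∈ [n]^b is sent to a polynomial L_u of
-- degree < b interpolating (unit multiples of) its coordinates at the nodes
-- t, …, t + b − 1, and gets the t colours (x, L_u(x) mod q) for x = 0, …, t − 1
-- out of t q colours. If u and v differ in d coordinates, L_u − L_v is a unit at
-- every colour point times a polynomial of degree < d that does not vanish
-- modulo q at a node where they differ, so u and v share fewer than d colours.
-- Since q can be taken below n + K! + 1, t q ≤ (1 + δ) t n for n large.
module Submission where

import Data.Bool as Bool
open import Data.Empty using (⊥-elim)
open import Data.Fin using (Fin; toℕ; fromℕ<; _≟_)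
import Data.Fin.Properties as Finₚ
open import Data.Fin.Subset using (Subset; Empty; _∩_; ∣_∣; ⁅_⁆; inside; outside)
import Data.Fin.Subset.Properties as Subsetₚ
open import Data.Integer as ℤ using (ℤ; +_; 0ℤ; 1ℤ; _+_; _*_; _-_; -_)
open import Data.Integer.Divisibility.Signed
open import Data.Integer.DivMod using (_/ℕ_; _%ℕ_; a≡a%ℕn+[a/ℕn]*n; n%ℕd<d)
import Data.Integer.Properties as ℤₚ
open import Data.Integer.Tactic.RingSolver using (solve-∀)
open import Data.Nat as ℕ using (ℕ; zero; suc; z≤n; s≤s; _≤_; _<_; _!; NonZero)
import Data.Nat.Divisibility as ℕ
import Data.Nat.DivMod as ℕ
import Data.Nat.Properties as ℕₚ
import Data.Nat.Tactic.RingSolver as ℕ-Ring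
open import Data.Product using (Σ; Σ-syntax; ∃-syntax; _×_; _,_; proj₁; proj₂)
open import Data.Rational as ℚ using (ℚ; mkℚ; ↥_; ↧ₙ_; _/_; 0ℚ; 1ℚ)
  renaming (_<_ to _<ℚ_; _≤_ to _≤ℚ_; _+_ to _+ℚ_; _*_ to _*ℚ_)
import Data.Rational.Properties as ℚₚ
import Data.Rational.Unnormalised as ℚᵘ
import Data.Rational.Unnormalised.Properties as ℚᵘₚ
open import Data.Vec using (Vec; []; _∷_; _++_)
import Data.Vec.Properties as Vecₚ
open import Data.Vec.Relation.Unary.All as All using (All; []; _∷_)
open import Data.Vec.Relation.Unary.AllPairs using (AllPairs; []; _∷_)
open import Function using (_∘_)
open import Relation.Binary.Definitions using (tri<; tri≈; tri>)
open import Relation.Binary.PropositionalEquality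
open import Relation.Nullary using (¬_; yes; no)

open import Defs

private
  variable
    k : ℕ

-- Polynomial functions, in divided-difference form

DegreeBelow : ℕ → (ℤ → ℤ) → Set
DegreeBelow zero    f = ∀ z → f z ≡ 0ℤ
DegreeBelow (suc d) f =
  ∀ a → Σ[ g ∈ (ℤ → ℤ) ] DegreeBelow d g × (∀ z → f z ≡ f a + (z - a) * g z)

degreeBelow-suc : ∀ d {f} → DegreeBelow d f → DegreeBelow (suc d) f
degreeBelow-suc zero    {f} f≡0 a = (λ _ → 0ℤ) , (λ _ → refl) , λ z → begin
  f z                   ≡⟨ trans (f≡0 z) (sym (f≡0 a)) ⟩
  f a                   ≡⟨ e (f a) (z - a) ⟩
  f a + (z - a) * 0ℤ    ∎
  where
  open ≡-Reasoning
  e : ∀ x y → x ≡ x + y * 0ℤ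
  e = solve-∀
degreeBelow-suc (suc d) f-deg a =
  let g , g-deg , f≡ = f-deg a in g , degreeBelow-suc d g-deg , f≡

degreeBelow-+ : ∀ d {f g} → DegreeBelow d f → DegreeBelow d g →
                DegreeBelow d (λ z → f z + g z)
degreeBelow-+ zero    f≡0 g≡0 z = cong₂ _+_ (f≡0 z) (g≡0 z)
degreeBelow-+ (suc d) {f} {g} f-deg g-deg a =
  let f′ , f′-deg , f≡ = f-deg a
      g′ , g′-deg , g≡ = g-deg a
  in (λ z → f′ z + g′ z) , degreeBelow-+ d f′-deg g′-deg ,
     λ z → trans (cong₂ _+_ (f≡ z) (g≡ z)) (e (f a) (g a) (z - a) (f′ z) (g′ z))
  where
  e : ∀ fa ga w x y → (fa + w * x) + (ga + w * y) ≡ (fa + ga) + w * (x + y)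
  e = solve-∀

degreeBelow-scale : ∀ d c {f} → DegreeBelow d f → DegreeBelow d (λ z → c * f z)
degreeBelow-scale zero    c f≡0 z = trans (cong (c *_) (f≡0 z)) (ℤₚ.*-zeroʳ c)
degreeBelow-scale (suc d) c {f} f-deg a =
  let g , g-deg , f≡ = f-deg a
  in (λ z → c * g z) , degreeBelow-scale d c g-deg ,
     λ z → trans (cong (c *_) (f≡ z)) (e c (f a) (z - a) (g z))
  where
  e : ∀ c fa w x → c * (fa + w * x) ≡ c * fa + w * (c * x)
  e = solve-∀

degreeBelow-const : ∀ c → DegreeBelow 1 (λ _ → c)
degreeBelow-const c a = (λ _ → 0ℤ) , (λ _ → refl) , λ z → e c (z - a)
  where
  e : ∀ x y → x ≡ x + y * 0ℤ
  e = solve-∀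

degreeBelow-linear : ∀ d y {f} → DegreeBelow d f → DegreeBelow (suc d) (λ z → (z - y) * f z)
degreeBelow-linear zero    y {f} f≡0 a = f , f≡0 , λ z → begin
  (z - y) * f z                      ≡⟨ cong ((z - y) *_) (f≡0 z) ⟩
  (z - y) * 0ℤ                       ≡⟨ e (z - y) (a - y) (z - a) ⟩
  (a - y) * 0ℤ + (z - a) * 0ℤ        ≡⟨ cong₂ (λ u v → (a - y) * u + (z - a) * v) (f≡0 a) (f≡0 z) ⟨
  (a - y) * f a + (z - a) * f z      ∎
  where
  open ≡-Reasoning
  e : ∀ w x v → w * 0ℤ ≡ x * 0ℤ + v * 0ℤ
  e = solve-∀
degreeBelow-linear (suc d) y {f} f-deg a =
  let g , g-deg , f≡ = f-deg a
  in (λ z → f z + (a - y) * g z) ,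
     degreeBelow-+ (suc d) f-deg (degreeBelow-scale (suc d) (a - y) (degreeBelow-suc d g-deg)) ,
     λ z → begin
       (z - y) * f z                                             ≡⟨ cong ((z - y) *_) (f≡ z) ⟩
       (z - y) * (f a + (z - a) * g z)                           ≡⟨ e a z y (f a) (g z) ⟩
       (a - y) * f a + (z - a) * ((f a + (z - a) * g z) + (a - y) * g z)
         ≡⟨ cong (λ w → (a - y) * f a + (z - a) * (w + (a - y) * g z)) (f≡ z) ⟨
       (a - y) * f a + (z - a) * (f z + (a - y) * g z)           ∎
  where
  open ≡-Reasoning
  e : ∀ a z y fa gz → (z - y) * (fa + (z - a) * gz)
                    ≡ (a - y) * fa + (z - a) * ((fa + (z - a) * gz) + (a - y) * gz)
  e = solve-∀

-- Counting roots modulo q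

module _ (q : ℤ) where

  Cancellable : ℤ → Set
  Cancellable a = ∀ g → q ∣ a * g → q ∣ g

  Apart : ℤ → ℤ → Set
  Apart x y = Cancellable (x - y) × Cancellable (y - x)

  Separated : Vec ℤ k → Set
  Separated = AllPairs Apart

  rootCount : (ℤ → ℤ) → Vec ℤ k → ℕ
  rootCount f []       = 0
  rootCount f (x ∷ xs) with q ∣? f x
  ... | yes _ = suc (rootCount f xs)
  ... | no  _ = rootCount f xs

  cancellable-1 : Cancellable 1ℤ
  cancellable-1 g = subst (q ∣_) (ℤₚ.*-identityˡ g)

  cancellable-* : ∀ a b → Cancellable a → Cancellable b → Cancellable (a * b)
  cancellable-* a b a-canc b-canc g q∣abg =
    b-canc g (a-canc (b * g) (subst (q ∣_) (ℤₚ.*-assoc a b g) q∣abg))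

  cancellable-neg : ∀ a → Cancellable a → Cancellable (- a)
  cancellable-neg a a-canc g q∣-ag =
    subst (q ∣_) (ℤₚ.neg-involutive g) (∣m⇒∣-m (a-canc (- g) (subst (q ∣_) (e a g) q∣-ag)))
    where
    e : ∀ a g → - a * g ≡ a * - g
    e = solve-∀

  rootCount-mono : ∀ {f g} (xs : Vec ℤ k) → All (λ x → q ∣ f x → q ∣ g x) xs →
                   rootCount f xs ≤ rootCount g xs
  rootCount-mono                 []       []            = z≤n
  rootCount-mono {f = f} {g = g} (x ∷ xs) (f⇒g ∷ fs⇒gs) with q ∣? f x | q ∣? g x
  ... | yes _   | yes _   = s≤s (rootCount-mono xs fs⇒gs)
  ... | yes q∣f | no  q∤g = ⊥-elim (q∤g (f⇒g q∣f))
  ... | no  _   | yes _   = ℕₚ.m≤n⇒m≤1+n (rootCount-mono xs fs⇒gs)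
  ... | no  _   | no  _   = rootCount-mono xs fs⇒gs

  -- Factor out a root x: since every later point y is apart from x, the
  -- roots of f among them are roots of the divided difference g.
  rootCount<degree : ∀ d {f z} (xs : Vec ℤ k) → DegreeBelow d f → Separated xs →
                     ¬ q ∣ f z → rootCount f xs < d
  rootCount<degree zero    {z = z} _ f≡0 _ q∤fz = ⊥-elim (q∤fz (subst (q ∣_) (sym (f≡0 z)) (divides 0ℤ refl)))
  rootCount<degree (suc d) []       _     _               _    = s≤s z≤n
  rootCount<degree (suc d) {f} {z} (x ∷ xs) f-deg (x-apart ∷ sep) q∤fz with q ∣? f x
  ... | no  _    = rootCount<degree (suc d) xs f-deg sep q∤fz
  ... | yes q∣fx with f-deg x
  ...   | g , g-deg , f≡ =
    s≤s (ℕₚ.≤-<-trans (rootCount-mono xs roots-descend) (rootCount<degree d xs g-deg sep q∤gz))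
    where
    roots-descend : All (λ y → q ∣ f y → q ∣ g y) xs
    roots-descend = All.map (λ {y} y-apart q∣fy →
      proj₂ y-apart (g y) (∣m+n∣m⇒∣n (subst (q ∣_) (f≡ y) q∣fy) q∣fx)) x-apart
    q∤gz : ¬ q ∣ g z
    q∤gz q∣gz = q∤fz (subst (q ∣_) (sym (f≡ z)) (∣m∣n⇒∣m+n q∣fx (∣n⇒∣m*n (z - x) q∣gz)))

-- Interpolation polynomials of vertices

coordinate : ∀ {n} → Fin n → ℤ
coordinate i = + toℕ i

module _ {n : ℕ} where

  nodePoly : Vec ℤ k → ℤ → ℤ
  nodePoly []       x = 1ℤ
  nodePoly (y ∷ ys) x = (x - y) * nodePoly ys x

  -- vertexPoly ys u x = Σᵢ uᵢ ∏_{j ≠ i} (x − yⱼ): up to the unit ∏_{j ≠ i} (yᵢ − yⱼ),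
  -- the interpolation polynomial of degree < k taking the value uᵢ at the node yᵢ.
  vertexPoly : Vec ℤ k → Vertex n k → ℤ → ℤ
  vertexPoly []       []       x = 0ℤ
  vertexPoly (y ∷ ys) (u ∷ us) x = coordinate u * nodePoly ys x + (x - y) * vertexPoly ys us x

  agreeProduct : Vec ℤ k → Vertex n k → Vertex n k → ℤ → ℤ
  agreeProduct []       []       []       x = 1ℤ
  agreeProduct (y ∷ ys) (u ∷ us) (v ∷ vs) x with u ≟ v
  ... | yes _ = (x - y) * agreeProduct ys us vs x
  ... | no  _ = agreeProduct ys us vs x

  disagreeProduct : Vec ℤ k → Vertex n k → Vertex n k → ℤ → ℤ
  disagreeProduct []       []       []       x = 1ℤ
  disagreeProduct (y ∷ ys) (u ∷ us) (v ∷ vs) x with u ≟ v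
  ... | yes _ = disagreeProduct ys us vs x
  ... | no  _ = (x - y) * disagreeProduct ys us vs x

  reducedDifference : Vec ℤ k → Vertex n k → Vertex n k → ℤ → ℤ
  reducedDifference []       []       []       x = 0ℤ
  reducedDifference (y ∷ ys) (u ∷ us) (v ∷ vs) x with u ≟ v
  ... | yes _ = reducedDifference ys us vs x
  ... | no  _ = (coordinate u - coordinate v) * disagreeProduct ys us vs x
              + (x - y) * reducedDifference ys us vs x

  nodePoly-split : ∀ (ys : Vec ℤ k) u v x →
                   nodePoly ys x ≡ agreeProduct ys u v x * disagreeProduct ys u v x
  nodePoly-split []       []       []       x = refl
  nodePoly-split (y ∷ ys) (u ∷ us) (v ∷ vs) x with u ≟ v
  ... | yes _ = trans (cong ((x - y) *_) (nodePoly-split ys us vs x))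
                      (e (x - y) (agreeProduct ys us vs x) (disagreeProduct ys us vs x))
    where
    e : ∀ a b c → a * (b * c) ≡ (a * b) * c
    e = solve-∀
  ... | no  _ = trans (cong ((x - y) *_) (nodePoly-split ys us vs x))
                      (e (x - y) (agreeProduct ys us vs x) (disagreeProduct ys us vs x))
    where
    e : ∀ a b c → a * (b * c) ≡ b * (a * c)
    e = solve-∀

  vertexPoly-difference : ∀ (ys : Vec ℤ k) u v x →
    vertexPoly ys u x - vertexPoly ys v x ≡ agreeProduct ys u v x * reducedDifference ys u v x
  vertexPoly-difference []       []       []       x = refl
  vertexPoly-difference (y ∷ ys) (u ∷ us) (v ∷ vs) x with u ≟ v
  ... | yes refl = begin
    (c * p + w * A) - (c * p + w * B)  ≡⟨ e c p w A B ⟩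
    w * (A - B)                        ≡⟨ cong (w *_) (vertexPoly-difference ys us vs x) ⟩
    w * (U * G)                        ≡⟨ ℤₚ.*-assoc w U G ⟨
    w * U * G                          ∎
    where
    open ≡-Reasoning
    c = coordinate u; p = nodePoly ys x; w = x - y
    A = vertexPoly ys us x; B = vertexPoly ys vs x
    U = agreeProduct ys us vs x; G = reducedDifference ys us vs x
    e : ∀ c p w A B → (c * p + w * A) - (c * p + w * B) ≡ w * (A - B)
    e = solve-∀
  ... | no _ = begin
    (cu * p + w * A) - (cv * p + w * B)  ≡⟨ e cu cv p w A B ⟩
    (cu - cv) * p + w * (A - B)
      ≡⟨ cong₂ (λ p′ d → (cu - cv) * p′ + w * d) (nodePoly-split ys us vs x) (vertexPoly-difference ys us vs x) ⟩
    (cu - cv) * (U * V) + w * (U * G)    ≡⟨ e′ (cu - cv) U V w G ⟩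
    U * ((cu - cv) * V + w * G)          ∎
    where
    open ≡-Reasoning
    cu = coordinate u; cv = coordinate v; p = nodePoly ys x; w = x - y
    A = vertexPoly ys us x; B = vertexPoly ys vs x
    U = agreeProduct ys us vs x; V = disagreeProduct ys us vs x; G = reducedDifference ys us vs x
    e : ∀ a b p w A B → (a * p + w * A) - (b * p + w * B) ≡ (a - b) * p + w * (A - B)
    e = solve-∀
    e′ : ∀ c U V w G → c * (U * V) + w * (U * G) ≡ U * (c * V + w * G)
    e′ = solve-∀

  disagreeProduct-degree : ∀ (ys : Vec ℤ k) u v →
                           DegreeBelow (suc (dist u v)) (disagreeProduct ys u v)
  disagreeProduct-degree []       []       []       = degreeBelow-const 1ℤ
  disagreeProduct-degree (y ∷ ys) (u ∷ us) (v ∷ vs) with u ≟ v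
  ... | yes _ = disagreeProduct-degree ys us vs
  ... | no  _ = degreeBelow-linear (suc (dist us vs)) y (disagreeProduct-degree ys us vs)

  reducedDifference-degree : ∀ (ys : Vec ℤ k) u v →
                             DegreeBelow (dist u v) (reducedDifference ys u v)
  reducedDifference-degree []       []       []       _ = refl
  reducedDifference-degree (y ∷ ys) (u ∷ us) (v ∷ vs) with u ≟ v
  ... | yes _ = reducedDifference-degree ys us vs
  ... | no  _ = degreeBelow-+ (suc (dist us vs))
      (degreeBelow-scale (suc (dist us vs)) (coordinate u - coordinate v) (disagreeProduct-degree ys us vs))
      (degreeBelow-linear (dist us vs) y (reducedDifference-degree ys us vs))

DistinctResidues : ℤ → ℕ → Set
DistinctResidues q n = ∀ (i j : Fin n) → i ≢ j → ¬ q ∣ coordinate i - coordinate j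

module _ (q : ℤ) {n : ℕ} where

  agreeProduct-cancellable : ∀ (ys : Vec ℤ k) (u v : Vertex n k) x →
    All (λ y → Cancellable q (x - y)) ys → Cancellable q (agreeProduct ys u v x)
  agreeProduct-cancellable []       []       []       x []               = cancellable-1 q
  agreeProduct-cancellable (y ∷ ys) (u ∷ us) (v ∷ vs) x (x-y-canc ∷ cs) with u ≟ v
  ... | yes _ = cancellable-* q (x - y) _ x-y-canc (agreeProduct-cancellable ys us vs x cs)
  ... | no  _ = agreeProduct-cancellable ys us vs x cs

  disagreeProduct-cancellable : ∀ (ys : Vec ℤ k) (u v : Vertex n k) x →
    All (λ y → Cancellable q (x - y)) ys → Cancellable q (disagreeProduct ys u v x)
  disagreeProduct-cancellable []       []       []       x []               = cancellable-1 q
  disagreeProduct-cancellable (y ∷ ys) (u ∷ us) (v ∷ vs) x (x-y-canc ∷ cs) with u ≟ v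
  ... | yes _ = disagreeProduct-cancellable ys us vs x cs
  ... | no  _ = cancellable-* q (x - y) _ x-y-canc (disagreeProduct-cancellable ys us vs x cs)

  -- Evaluate at the node of the first coordinate where u and v differ.
  reducedDifference-nonvanishing : ∀ (ys : Vec ℤ k) (u v : Vertex n k) →
    Separated q ys → DistinctResidues q n → u ≢ v → ∃[ z ] ¬ q ∣ reducedDifference ys u v z
  reducedDifference-nonvanishing []       []       []       _                _        u≢v = ⊥-elim (u≢v refl)
  reducedDifference-nonvanishing (y ∷ ys) (u ∷ us) (v ∷ vs) (y-apart ∷ sep) distinct u≢v with u ≟ v
  ... | yes refl = reducedDifference-nonvanishing ys us vs sep distinct (u≢v ∘ cong (u ∷_))
  ... | no  u≢v′ = y , λ q∣G[y] → distinct u v u≢v′ (V-cancellable c (subst (q ∣_) (e c V y G) q∣G[y]))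
    where
    c = coordinate u - coordinate v
    V = disagreeProduct ys us vs y
    G = reducedDifference ys us vs y
    V-cancellable : Cancellable q V
    V-cancellable = disagreeProduct-cancellable ys us vs y (All.map proj₁ y-apart)
    e : ∀ c V y G → c * V + (y - y) * G ≡ V * c
    e = solve-∀

  rootCount-vertexPoly-difference<dist : ∀ {m} (ys : Vec ℤ k) (xs : Vec ℤ m) (u v : Vertex n k) →
    Separated q ys → Separated q xs → All (λ x → All (λ y → Cancellable q (x - y)) ys) xs →
    DistinctResidues q n → u ≢ v →
    rootCount q (λ x → vertexPoly ys u x - vertexPoly ys v x) xs < dist u v
  rootCount-vertexPoly-difference<dist ys xs u v ys-sep xs-sep xs-ys-canc distinct u≢v =
    let z , q∤Gz = reducedDifference-nonvanishing ys u v ys-sep distinct u≢v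
    in ℕₚ.≤-<-trans (rootCount-mono q xs (All.map root-of-reduced xs-ys-canc))
                    (rootCount<degree q (dist u v) xs (reducedDifference-degree ys u v) xs-sep q∤Gz)
    where
    root-of-reduced : ∀ {x} → All (λ y → Cancellable q (x - y)) ys →
      q ∣ vertexPoly ys u x - vertexPoly ys v x → q ∣ reducedDifference ys u v x
    root-of-reduced {x} cs q∣diff = agreeProduct-cancellable ys u v x cs _
      (subst (q ∣_) (vertexPoly-difference ys u v x) q∣diff)

-- a has inverse −b modulo 1 + a b.
cancellable-1+* : ∀ a b → Cancellable (1ℤ + a * b) a
cancellable-1+* a b g q∣ag =
  subst (q ∣_) (e a b g) (∣m∣n⇒∣m-n (∣m⇒∣m*n g ∣-refl) (∣n⇒∣m*n b q∣ag))
  where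
  q = 1ℤ + a * b
  e : ∀ a b g → (1ℤ + a * b) * g - b * (a * g) ≡ g
  e = solve-∀

modulus : ℕ → ℕ → ℕ
modulus K c = suc (K ! ℕ.* c)

-- d divides K!, say K! = e d, so modulus K c = 1 + d (e c).
cancellable-small : ∀ K c d → 1 ≤ d → d ≤ K → Cancellable (+ modulus K c) (+ d)
cancellable-small K c d@(suc d′) _ d≤K with ℕ.∣-trans (ℕ.m∣m*n (d′ !)) (ℕ.m≤n⇒m!∣n! d≤K)
... | ℕ.divides e K!≡ed = subst (λ q → Cancellable q (+ d)) (sym modulus≡) (cancellable-1+* (+ d) (+ (e ℕ.* c)))
  where
  modulus≡ : + modulus K c ≡ 1ℤ + + d * + (e ℕ.* c)
  modulus≡ = begin
    1ℤ + + (K ! ℕ.* c)          ≡⟨ cong (λ m → 1ℤ + + (m ℕ.* c)) (trans K!≡ed (ℕₚ.*-comm e d)) ⟩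
    1ℤ + + (d ℕ.* e ℕ.* c)      ≡⟨ cong (λ m → 1ℤ + + m) (ℕₚ.*-assoc d e c) ⟩
    1ℤ + + (d ℕ.* (e ℕ.* c))    ≡⟨ cong (λ m → 1ℤ + m) (ℤₚ.pos-* d (e ℕ.* c)) ⟩
    1ℤ + + d * + (e ℕ.* c)      ∎
    where open ≡-Reasoning

[+j]-[+i]≡+[j∸i] : ∀ {i j} → i ≤ j → + j - + i ≡ + (j ℕ.∸ i)
[+j]-[+i]≡+[j∸i] {i} {j} i≤j = trans (ℤₚ.m-n≡m⊖n j i) (ℤₚ.⊖-≥ i≤j)

[+i]-[+j]≡-+[j∸i] : ∀ {i j} → i ≤ j → + i - + j ≡ - + (j ℕ.∸ i)
[+i]-[+j]≡-+[j∸i] {i} {j} i≤j = trans (ℤₚ.m-n≡m⊖n i j) (ℤₚ.⊖-≤ i≤j)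

apart-modulus : ∀ K c {i j} → i < j → j ≤ K → Apart (+ modulus K c) (+ i) (+ j)
apart-modulus K c {i} {j} i<j j≤K =
  subst (Cancellable q) (sym ([+i]-[+j]≡-+[j∸i] (ℕₚ.<⇒≤ i<j))) (cancellable-neg q (+ (j ℕ.∸ i)) gap-cancellable) ,
  subst (Cancellable q) (sym ([+j]-[+i]≡+[j∸i] (ℕₚ.<⇒≤ i<j))) gap-cancellable
  where
  q = + modulus K c
  gap-cancellable : Cancellable q (+ (j ℕ.∸ i))
  gap-cancellable = cancellable-small K c (j ℕ.∸ i) (ℕₚ.m<n⇒0<n∸m i<j) (ℕₚ.≤-trans (ℕₚ.m∸n≤m j i) j≤K)

∣m-n⇒∣n-m : ∀ {q} x y → q ∣ x - y → q ∣ y - x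
∣m-n⇒∣n-m {q} x y q∣x-y = subst (q ∣_) (e x y) (∣m⇒∣-m q∣x-y)
  where
  e : ∀ x y → - (x - y) ≡ y - x
  e = solve-∀

small-difference-indivisible : ∀ {q a b} → a < b → b < q → ¬ + q ∣ + a - + b
small-difference-indivisible {q} {a} {b} a<b b<q q∣a-b =
  ℕ.>⇒∤ {{ℕ.>-nonZero (ℕₚ.m<n⇒0<n∸m a<b)}} (ℕₚ.≤-<-trans (ℕₚ.m∸n≤m b a) b<q)
    (subst (q ℕ.∣_) ∣a-b∣≡b∸a (∣⇒∣ᵤ q∣a-b))
  where
  ∣a-b∣≡b∸a : ℤ.∣ + a - + b ∣ ≡ b ℕ.∸ a
  ∣a-b∣≡b∸a = trans (cong ℤ.∣_∣ ([+i]-[+j]≡-+[j∸i] (ℕₚ.<⇒≤ a<b))) (ℤₚ.∣-i∣≡∣i∣ (+ (b ℕ.∸ a)))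

distinctResidues : ∀ {q n} → n ≤ q → DistinctResidues (+ q) n
distinctResidues {q} {n} n≤q i j i≢j q∣i-j with ℕₚ.<-cmp (toℕ i) (toℕ j)
... | tri< i<j _ _ = small-difference-indivisible i<j (ℕₚ.<-≤-trans (Finₚ.toℕ<n j) n≤q) q∣i-j
... | tri≈ _ i≡j _ = i≢j (Finₚ.toℕ-injective i≡j)
... | tri> _ _ j<i = small-difference-indivisible j<i (ℕₚ.<-≤-trans (Finₚ.toℕ<n i) n≤q)
                       (∣m-n⇒∣n-m (coordinate i) (coordinate j) q∣i-j)

range : ℕ → (k : ℕ) → Vec ℤ k
range s zero    = []
range s (suc k) = + s ∷ range (suc s) k

all-range : ∀ {P : ℤ → Set} s k → (∀ i → s ≤ i → i < s ℕ.+ k → P (+ i)) → All P (range s k)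
all-range s zero    _       = []
all-range s (suc k) P-range =
  P-range s ℕₚ.≤-refl (ℕₚ.m<m+n s (s≤s z≤n)) ∷
  all-range (suc s) k λ i s<i i<end → P-range i (ℕₚ.<⇒≤ s<i) (subst (i <_) (sym (ℕₚ.+-suc s k)) i<end)

allPairs-range : ∀ {R : ℤ → ℤ → Set} s k → (∀ i j → s ≤ i → i < j → j < s ℕ.+ k → R (+ i) (+ j)) →
                 AllPairs R (range s k)
allPairs-range s zero    _       = []
allPairs-range s (suc k) R-range =
  all-range (suc s) k (λ j s<j j<end → R-range s j ℕₚ.≤-refl s<j (shift j<end)) ∷
  allPairs-range (suc s) k λ i j s<i i<j j<end → R-range i j (ℕₚ.<⇒≤ s<i) i<j (shift j<end)
  where
  shift : ∀ {j} → j < suc s ℕ.+ k → j < s ℕ.+ suc k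
  shift {j} = subst (j <_) (sym (ℕₚ.+-suc s k))

∣p++q∣≡∣p∣+∣q∣ : ∀ {a b} (p : Subset a) (p′ : Subset b) → ∣ p ++ p′ ∣ ≡ ∣ p ∣ ℕ.+ ∣ p′ ∣
∣p++q∣≡∣p∣+∣q∣ []            p′ = refl
∣p++q∣≡∣p∣+∣q∣ (inside  ∷ p) p′ = cong suc (∣p++q∣≡∣p∣+∣q∣ p p′)
∣p++q∣≡∣p∣+∣q∣ (outside ∷ p) p′ = ∣p++q∣≡∣p∣+∣q∣ p p′

∣⁅x⁆∩⁅y⁆∣≤1 : ∀ {a} (x y : Fin a) → ∣ ⁅ x ⁆ ∩ ⁅ y ⁆ ∣ ≤ 1
∣⁅x⁆∩⁅y⁆∣≤1 x y = ℕₚ.≤-trans (Subsetₚ.p⊆q⇒∣p∣≤∣q∣ (Subsetₚ.p∩q⊆p ⁅ x ⁆ ⁅ y ⁆))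
                             (ℕₚ.≤-reflexive (Subsetₚ.∣⁅x⁆∣≡1 x))

∣⁅x⁆∩⁅y⁆∣≡0 : ∀ {a} (x y : Fin a) → x ≢ y → ∣ ⁅ x ⁆ ∩ ⁅ y ⁆ ∣ ≡ 0
∣⁅x⁆∩⁅y⁆∣≡0 {a} x y x≢y = trans (cong ∣_∣ (Subsetₚ.Empty-unique empty)) (Subsetₚ.∣⊥∣≡0 a)
  where
  empty : Empty (⁅ x ⁆ ∩ ⁅ y ⁆)
  empty (z , z∈) = let z∈x , z∈y = Subsetₚ.x∈p∩q⁻ ⁅ x ⁆ ⁅ y ⁆ z∈
                   in x≢y (trans (sym (Subsetₚ.x∈⁅y⁆⇒x≡y x z∈x)) (Subsetₚ.x∈⁅y⁆⇒x≡y y z∈y))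

module _ (q : ℕ) .{{_ : NonZero q}} where

  residue : ℤ → Fin q
  residue a = fromℕ< (n%ℕd<d a q)

  residue-≡⇒∣ : ∀ a b → residue a ≡ residue b → + q ∣ a - b
  residue-≡⇒∣ a b ra≡rb = divides (a /ℕ q - b /ℕ q) (begin
    a - b
      ≡⟨ cong₂ _-_ (a≡a%ℕn+[a/ℕn]*n a q) (a≡a%ℕn+[a/ℕn]*n b q) ⟩
    (+ (a %ℕ q) + a /ℕ q * + q) - (+ (b %ℕ q) + b /ℕ q * + q)
      ≡⟨ cong (λ r → (+ (a %ℕ q) + a /ℕ q * + q) - (+ r + b /ℕ q * + q)) %-equal ⟨
    (+ (a %ℕ q) + a /ℕ q * + q) - (+ (a %ℕ q) + b /ℕ q * + q)
      ≡⟨ e (+ (a %ℕ q)) (a /ℕ q) (b /ℕ q) (+ q) ⟩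
    (a /ℕ q - b /ℕ q) * + q ∎)
    where
    open ≡-Reasoning
    %-equal : a %ℕ q ≡ b %ℕ q
    %-equal = trans (sym (Finₚ.toℕ-fromℕ< (n%ℕd<d a q)))
                    (trans (cong toℕ ra≡rb) (Finₚ.toℕ-fromℕ< (n%ℕd<d b q)))
    e : ∀ r x y q → (r + x * q) - (r + y * q) ≡ (x - y) * q
    e = solve-∀

  colouring : Vec ℤ k → (ℤ → ℤ) → Subset (k ℕ.* q)
  colouring []       h = []
  colouring (x ∷ xs) h = ⁅ residue (h x) ⁆ ++ colouring xs h

  ∣colouring∣ : ∀ (xs : Vec ℤ k) h → ∣ colouring xs h ∣ ≡ k
  ∣colouring∣ []       h = refl
  ∣colouring∣ (x ∷ xs) h = begin
    ∣ ⁅ residue (h x) ⁆ ++ colouring xs h ∣       ≡⟨ ∣p++q∣≡∣p∣+∣q∣ ⁅ residue (h x) ⁆ (colouring xs h) ⟩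
    ∣ ⁅ residue (h x) ⁆ ∣ ℕ.+ ∣ colouring xs h ∣  ≡⟨ cong₂ ℕ._+_ (Subsetₚ.∣⁅x⁆∣≡1 (residue (h x))) (∣colouring∣ xs h) ⟩
    suc _                                          ∎
    where open ≡-Reasoning

  ∣colouring∩colouring∣≤rootCount : ∀ (xs : Vec ℤ k) h h′ →
    ∣ colouring xs h ∩ colouring xs h′ ∣ ≤ rootCount (+ q) (λ x → h x - h′ x) xs
  ∣colouring∩colouring∣≤rootCount []       h h′ = z≤n
  ∣colouring∩colouring∣≤rootCount (x ∷ xs) h h′
    rewrite Vecₚ.zipWith-++ Bool._∧_ ⁅ residue (h x) ⁆ (colouring xs h) ⁅ residue (h′ x) ⁆ (colouring xs h′)
          | ∣p++q∣≡∣p∣+∣q∣ (⁅ residue (h x) ⁆ ∩ ⁅ residue (h′ x) ⁆) (colouring xs h ∩ colouring xs h′)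
    with + q ∣? h x - h′ x
  ... | yes _   = ℕₚ.+-mono-≤ (∣⁅x⁆∩⁅y⁆∣≤1 (residue (h x)) (residue (h′ x)))
                              (∣colouring∩colouring∣≤rootCount xs h h′)
  ... | no  q∤d = subst (λ c → c ℕ.+ _ ≤ _)
                        (sym (∣⁅x⁆∩⁅y⁆∣≡0 (residue (h x)) (residue (h′ x)) (q∤d ∘ residue-≡⇒∣ (h x) (h′ x))))
                        (∣colouring∩colouring∣≤rootCount xs h h′)

toneColouring : ∀ t b n c → Vertex n b → Subset (t ℕ.* modulus (t ℕ.+ b) c)
toneColouring t b n c u = colouring (modulus (t ℕ.+ b) c) (range 0 t) (vertexPoly (range t b) u)

toneColouring-isToneColoring : ∀ t b n c → n ≤ modulus (t ℕ.+ b) c →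
  IsToneColoring t n b (t ℕ.* modulus (t ℕ.+ b) c) (toneColouring t b n c)
toneColouring-isToneColoring t b n c n≤q =
  (λ u → ∣colouring∣ q xs (vertexPoly ys u)) ,
  λ u v u≢v → ℕₚ.≤-<-trans
    (∣colouring∩colouring∣≤rootCount q xs (vertexPoly ys u) (vertexPoly ys v))
    (rootCount-vertexPoly-difference<dist (+ q) ys xs u v
      ys-separated xs-separated xs-ys-cancellable (distinctResidues n≤q) u≢v)
  where
  K = t ℕ.+ b
  q = modulus K c
  xs = range 0 t
  ys = range t b
  apart : ∀ {i j} → i < j → j < K → Apart (+ q) (+ i) (+ j)
  apart i<j j<K = apart-modulus K c i<j (ℕₚ.<⇒≤ j<K)
  ys-separated : Separated (+ q) ys
  ys-separated = allPairs-range t b λ i j _ i<j j<K → apart i<j j<K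
  xs-separated : Separated (+ q) xs
  xs-separated = allPairs-range 0 t λ i j _ i<j j<t → apart i<j (ℕₚ.<-≤-trans j<t (ℕₚ.m≤m+n t b))
  xs-ys-cancellable : All (λ x → All (λ y → Cancellable (+ q) (x - y)) ys) xs
  xs-ys-cancellable = all-range 0 t λ i _ i<t → all-range t b λ j t≤j j<K →
    proj₁ (apart (ℕₚ.<-≤-trans i<t t≤j) j<K)

modulus-near : ∀ K n → ∃[ c ] (n ≤ modulus K c × modulus K c ≤ n ℕ.+ suc (K !))
modulus-near K n = suc (n ℕ./ M) , n≤q , q≤n+M+1
  where
  open ℕₚ.≤-Reasoning
  M = K !
  instance
    M≢0 : NonZero M
    M≢0 = K ℕₚ.!≢0
  n≤q : n ≤ modulus K (suc (n ℕ./ M))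
  n≤q = begin
    n                                 ≡⟨ ℕ.m≡m%n+[m/n]*n n M ⟩
    n ℕ.% M ℕ.+ n ℕ./ M ℕ.* M         ≤⟨ ℕₚ.+-monoˡ-≤ (n ℕ./ M ℕ.* M) (ℕₚ.<⇒≤ (ℕ.m%n<n n M)) ⟩
    M ℕ.+ n ℕ./ M ℕ.* M               ≡⟨ cong (M ℕ.+_) (ℕₚ.*-comm (n ℕ./ M) M) ⟩
    M ℕ.+ M ℕ.* (n ℕ./ M)             ≡⟨ ℕₚ.*-suc M (n ℕ./ M) ⟨
    M ℕ.* suc (n ℕ./ M)               ≤⟨ ℕₚ.n≤1+n _ ⟩
    modulus K (suc (n ℕ./ M))         ∎
  q≤n+M+1 : modulus K (suc (n ℕ./ M)) ≤ n ℕ.+ suc M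
  q≤n+M+1 = begin
    suc (M ℕ.* suc (n ℕ./ M))         ≡⟨ cong suc (ℕₚ.*-suc M (n ℕ./ M)) ⟩
    suc (M ℕ.+ M ℕ.* (n ℕ./ M))       ≡⟨ cong (λ x → suc (M ℕ.+ x)) (ℕₚ.*-comm M (n ℕ./ M)) ⟩
    suc (M ℕ.+ n ℕ./ M ℕ.* M)         ≤⟨ s≤s (ℕₚ.+-monoʳ-≤ M (ℕ.m/n*n≤m n M)) ⟩
    suc (M ℕ.+ n)                     ≡⟨ cong suc (ℕₚ.+-comm M n) ⟩
    suc (n ℕ.+ M)                     ≡⟨ ℕₚ.+-suc n M ⟨
    n ℕ.+ suc M                       ∎

-- With δ = (1 + p)/D ≥ 1/D: a palette of t q ≤ t (n + s) colours fits in (1 + δ) t n once s D ≤ n.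
excess-absorbed : ∀ t n q s D p → q ≤ n ℕ.+ s → s ℕ.* D ≤ n → t ℕ.* q ℕ.* D ≤ (D ℕ.+ suc p) ℕ.* (t ℕ.* n)
excess-absorbed t n q s D p q≤n+s sD≤n = begin
  t ℕ.* q ℕ.* D                                 ≤⟨ ℕₚ.*-monoˡ-≤ D (ℕₚ.*-monoʳ-≤ t q≤n+s) ⟩
  t ℕ.* (n ℕ.+ s) ℕ.* D                         ≡⟨ e₁ t n s D ⟩
  t ℕ.* n ℕ.* D ℕ.+ t ℕ.* (s ℕ.* D)             ≤⟨ ℕₚ.+-monoʳ-≤ (t ℕ.* n ℕ.* D) (ℕₚ.*-monoʳ-≤ t sD≤n) ⟩
  t ℕ.* n ℕ.* D ℕ.+ t ℕ.* n                     ≤⟨ ℕₚ.m≤m+n _ (p ℕ.* (t ℕ.* n)) ⟩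
  t ℕ.* n ℕ.* D ℕ.+ t ℕ.* n ℕ.+ p ℕ.* (t ℕ.* n) ≡⟨ e₂ t n D p ⟩
  (D ℕ.+ suc p) ℕ.* (t ℕ.* n)                   ∎
  where
  open ℕₚ.≤-Reasoning
  e₁ : ∀ t n s D → t ℕ.* (n ℕ.+ s) ℕ.* D ≡ t ℕ.* n ℕ.* D ℕ.+ t ℕ.* (s ℕ.* D)
  e₁ = ℕ-Ring.solve-∀
  e₂ : ∀ t n D p → t ℕ.* n ℕ.* D ℕ.+ t ℕ.* n ℕ.+ p ℕ.* (t ℕ.* n) ≡ (D ℕ.+ suc p) ℕ.* (t ℕ.* n)
  e₂ = ℕ-Ring.solve-∀

≤ᵘ-1+δ* : ∀ A B p d → A ℕ.* suc d ≤ (suc d ℕ.+ p) ℕ.* B →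
           ℚᵘ.mkℚᵘ (+ A) 0 ℚᵘ.≤ (ℚᵘ.1ℚᵘ ℚᵘ.+ ℚᵘ.mkℚᵘ (+ p) d) ℚᵘ.* ℚᵘ.mkℚᵘ (+ B) 0
≤ᵘ-1+δ* A B p d Ad≤[d+p]B = ℚᵘ.*≤* (subst₂ ℤ._≤_ (sym lhs≡) (sym rhs≡) (ℤ.+≤+ Ad≤[d+p]B))
  where
  open ≡-Reasoning
  lhs≡ : + A * + suc ((d ℕ.+ 0) ℕ.* 1) ≡ + (A ℕ.* suc d)
  lhs≡ = begin
    + A * + suc ((d ℕ.+ 0) ℕ.* 1)   ≡⟨ cong (λ d′ → + A * + suc d′) (trans (ℕₚ.*-identityʳ _) (ℕₚ.+-identityʳ d)) ⟩
    + A * + suc d                   ≡⟨ ℤₚ.pos-* A (suc d) ⟨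
    + (A ℕ.* suc d)                 ∎
  rhs≡ : ((1ℤ * + suc d + + p * 1ℤ) * + B) * 1ℤ ≡ + ((suc d ℕ.+ p) ℕ.* B)
  rhs≡ = begin
    ((1ℤ * + suc d + + p * 1ℤ) * + B) * 1ℤ   ≡⟨ e (+ suc d) (+ p) (+ B) ⟩
    (+ suc d + + p) * + B                   ≡⟨ cong (_* + B) (ℤₚ.pos-+ (suc d) p) ⟨
    + (suc d ℕ.+ p) * + B                   ≡⟨ ℤₚ.pos-* (suc d ℕ.+ p) B ⟨
    + ((suc d ℕ.+ p) ℕ.* B)                 ∎
    where
    e : ∀ x y z → ((1ℤ * x + y * 1ℤ) * z) * 1ℤ ≡ (x + y) * z
    e = solve-∀

≤-1+δ* : ∀ A B (δ : ℚ) p → ↥ δ ≡ + p → A ℕ.* ↧ₙ δ ≤ (↧ₙ δ ℕ.+ p) ℕ.* B →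
         (+ A) / 1 ≤ℚ (1ℚ +ℚ δ) *ℚ ((+ B) / 1)
≤-1+δ* A B δ@(mkℚ _ d _) p refl AD≤[D+p]B = ℚₚ.toℚᵘ-cancel-≤ (begin
  ℚ.toℚᵘ ((+ A) / 1)                               ≃⟨ ℚₚ.toℚᵘ-fromℚᵘ (ℚᵘ.mkℚᵘ (+ A) 0) ⟩
  ℚᵘ.mkℚᵘ (+ A) 0                                  ≤⟨ ≤ᵘ-1+δ* A B p d AD≤[D+p]B ⟩
  (ℚᵘ.1ℚᵘ ℚᵘ.+ ℚ.toℚᵘ δ) ℚᵘ.* ℚᵘ.mkℚᵘ (+ B) 0       ≃⟨ ℚᵘₚ.*-cong (ℚₚ.toℚᵘ-homo-+ 1ℚ δ) (ℚₚ.toℚᵘ-fromℚᵘ (ℚᵘ.mkℚᵘ (+ B) 0)) ⟨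
  ℚ.toℚᵘ (1ℚ +ℚ δ) ℚᵘ.* ℚ.toℚᵘ ((+ B) / 1)          ≃⟨ ℚₚ.toℚᵘ-homo-* (1ℚ +ℚ δ) ((+ B) / 1) ⟨
  ℚ.toℚᵘ ((1ℚ +ℚ δ) *ℚ ((+ B) / 1))                ∎)
  where open ℚᵘₚ.≤-Reasoning

↥-positive : ∀ δ → 0ℚ <ℚ δ → ∃[ p ] ↥ δ ≡ + suc p
↥-positive (mkℚ (+ suc p)  _ _) _                    = p , refl
↥-positive (mkℚ (+ zero)   _ _) (ℚ.*<* (ℤ.+<+ ()))
↥-positive (mkℚ ℤ.-[1+ _ ] _ _) (ℚ.*<* ())

theorem1p15 : (b t : ℕ) → 1 ≤ b → 1 ≤ t → (δ : ℚ) → 0ℚ <ℚ δ →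
    ∃[ N ] ((n : ℕ) → N ≤ n →
      ∃[ m ] (((+ m) / 1 ≤ℚ (1ℚ +ℚ δ) *ℚ ((+ (t ℕ.* n)) / 1)) ×
              Σ (Vertex n b → Subset m) (IsToneColoring t n b m)))
theorem1p15 b t _ _ δ 0<δ =
  let p , ↥δ≡ = ↥-positive δ 0<δ in
  suc (K !) ℕ.* ↧ₙ δ , λ n N≤n →
    let c , n≤q , q≤n+K!+1 = modulus-near K n in
    t ℕ.* modulus K c ,
    ≤-1+δ* (t ℕ.* modulus K c) (t ℕ.* n) δ (suc p) ↥δ≡
      (excess-absorbed t n (modulus K c) (suc (K !)) (↧ₙ δ) p q≤n+K!+1 N≤n) ,
    toneColouring t b n c , toneColouring-isToneColoring t b n c n≤q
  where
  K = t ℕ.+ b
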